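{- Let $\mathcal{A}$ be a finite alphabet, $k\ge1$, and $\mathcal{A}^{\ge k}$ the $\mathbb{K}$-vector space spanned by the words of length at least $k$ on $\mathcal{A}$. Endowed with the operations $X\,\omega\,Y$ ($\omega\in\mathcal{O}_k$) defined in the context, $\mathcal{A}^{\ge k}$ is an algebra over the tidy series $k$-citelangis operad, and the concatenation product of $\mathcal{A}^{\ge k}$ coincides with the operation $\prec^k=\prec\prec\cdots\prec$.
   Context: $\mathcal{O}_k=\{\prec,\succ\}^k$. For a word $\omega\in\{\prec,\succ\}^*$ and words $X,Y$ with $|\omega|\le\min(|X|,|Y|)$, define inductively: $X\,\varepsilon\,Y=XY$ (concatenation); if $\omega=\prec\omega'$ and $X=xX'$ ($x$ a letter) then $X\,\omega\,Y=x\,(X'\,\omega'\,Y)$; if $\omega=\succ\omega'$ and $Y=yY'$ then $X\,\omega\,Y=y\,(X\,\omega'\,Y')$. (So the $i$-th letter of the result is taken from the front of $X$ if $\omega_i=\prec$ and from the front of $Y$ if $\omega_i=\succ$, then the remaining suffix of $X$ is followed by the remaining suffix of $Y$.) Extend bilinearly. The tidy series $k$-citelangis operad is the non-symmetric operad with binary generators $\mathcal{O}_k$ and, for each $p=(p_1,\dots,p_k)\in\{1,2,3\}^k$, the relation $x\,a_p\,(y\,b_p\,z)=(x\,d_p\,y)\,c_p\,z$, i.e. $a_p\circ_2 b_p=c_p\circ_1 d_p$, where for $L\subseteq\{1,2,3\}$, $p^L$ denotes the subword of $p$ of letters in $L$, and for $i\in[k]$: $(a_p)_i=\prec$ if $p_i=1$,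 $\succ$ if $p_i\in\{2,3\}$; $(b_p)_i=\prec$ if $(p^{\{2,3\}})_i=2$, $\succ$ if $(p^{\{2,3\}})_i=3$, $\prec$ if $|p^{\{2,3\}}|<i$; $(c_p)_i=\prec$ if $p_i\in\{1,2\}$, $\succ$ if $p_i=3$; $(d_p)_i=\prec$ if $(p^{\{1,2\}})_i=1$, $\succ$ if $(p^{\{1,2\}})_i=2$, $\prec$ if $|p^{\{1,2\}}|<i$. (This operad is the Koszul dual of the tidy series $k$-signaletic operad.) -}

module Defs where

open import Data.Nat using (ℕ; zero; suc)
open import Data.Fin using (Fin; toℕ)
open import Data.List using (List; []; _∷_; _++_)
open import Data.Vec using (Vec; []; _∷_; tabulate; toList)
open import Data.Maybe using (Maybe; just; nothing)

-- The two letters of the operation alphabet: ≺ (take from the left word)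
-- and ≻ (take from the right word).
data Op : Set where
  ≺ ≻ : Op

data P : Set where
  p1 p2 p3 : P

-- Only meaningful when |ω| ≤ min(|X|,|Y|); the last clause is a junk value
-- that is never reached under that hypothesis.
act : ∀ {m : ℕ} {A : Set} → Vec Op m → List A → List A → List A
act [] X Y = X ++ Y
act (≺ ∷ ω) (x ∷ X) Y = x ∷ act ω X Y
act (≻ ∷ ω) X (y ∷ Y) = y ∷ act ω X Y
act (_ ∷ _) X Y = X ++ Y

sub23 : List P → List P
sub23 [] = []
sub23 (p1 ∷ ps) = sub23 ps
sub23 (p2 ∷ ps) = p2 ∷ sub23 ps
sub23 (p3 ∷ ps) = p3 ∷ sub23 ps

sub12 : List P → List P
sub12 [] = []
sub12 (p1 ∷ ps) = p1 ∷ sub12 ps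
sub12 (p2 ∷ ps) = p2 ∷ sub12 ps
sub12 (p3 ∷ ps) = sub12 ps

-- (0-based) n-th letter of a list, if it exists
nth : {X : Set} → List X → ℕ → Maybe X
nth [] _ = nothing
nth (x ∷ xs) zero = just x
nth (x ∷ xs) (suc n) = nth xs n

aOp : P → Op
aOp p1 = ≺
aOp p2 = ≻
aOp p3 = ≻

cOp : P → Op
cOp p1 = ≺
cOp p2 = ≺
cOp p3 = ≻

-- (b_p)_i : ≺ if (p^{23})_i = 2, ≻ if = 3, ≺ if |p^{23}| < i
bAt : Maybe P → Op
bAt (just p3) = ≻
bAt _ = ≺

-- (d_p)_i : ≺ if (p^{12})_i = 1, ≻ if = 2, ≺ if |p^{12}| < i
dAt : Maybe P → Op
dAt (just p2) = ≻
dAt _ = ≺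

a c b d : ∀ {k : ℕ} → Vec P k → Vec Op k
a {k} p = tabulate λ i → aOp (Data.Vec.lookup p i)
c {k} p = tabulate λ i → cOp (Data.Vec.lookup p i)
b {k} p = tabulate λ i → bAt (nth (sub23 (toList p)) (toℕ i))
d {k} p = tabulate λ i → dAt (nth (sub12 (toList p)) (toℕ i))

precᵏ : (k : ℕ) → Vec Op k
precᵏ k = Data.Vec.replicate k ≺

-- X ω Y is the shuffle that draws its first |ω| letters from the fronts of X
-- and Y as ω dictates and then concatenates what is left, so its length is
-- |X| + |Y| and ≺ᵏ is plain concatenation. For the relation, read p from left
-- to right: pᵢ = 1, 2, 3 says that the i-th letter of both sides is the next
-- letter of X, Y, Z respectively. On the left, aₚ sends 1 to X and 2, 3 to
-- Y bₚ Z, in which bₚ follows p^{23}; on the right, cₚ sends 1, 2 to X dₚ Y, in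
-- which dₚ follows p^{12}, and 3 to Z. The trailing ≺'s of bₚ and dₚ only
-- concatenate once their subword is used up.
module Submission where

open import Defs
open import Data.Nat using (ℕ; _≤_; _+_)
open import Data.Fin using (Fin)
open import Data.Vec using (Vec)
open import Data.List using (List; length; _++_)
open import Data.Product using (_×_)
open import Relation.Binary.PropositionalEquality using (_≡_)

open import Function using (_∘_)
open import Data.Nat using (zero; suc; _∸_; z≤n; s≤s)
open import Data.Nat.Properties using (≤-trans; m≤m+n; m≤n⇒m≤1+n; <⇒≤; +-suc)
open import Data.Fin using (toℕ)
open import Data.List using ([]; _∷_; map; replicate)
open import Data.List.Properties using (++-assoc; length-++)
open import Data.Vec using ([]; _∷_; toList; tabulate; lookup)
open import Data.Vec.Properties
  using (length-toList; toList-replicate; toList-map; tabulate-∘; tabulate∘lookup)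
import Data.Vec as Vec
open import Data.Maybe using (Maybe; just; nothing)
open import Data.Product using (_,_)
open import Relation.Binary.PropositionalEquality
  using (refl; cong; sym; trans; subst; module ≡-Reasoning)

private
  variable
    A B : Set
    k : ℕ

actList : List Op → List A → List A → List A
actList [] X Y = X ++ Y
actList (≺ ∷ ω) (x ∷ X) Y = x ∷ actList ω X Y
actList (≻ ∷ ω) X (y ∷ Y) = y ∷ actList ω X Y
actList (_ ∷ _) X Y = X ++ Y

act≡actList-toList : (ω : Vec Op k) (X Y : List A) → act ω X Y ≡ actList (toList ω) X Y
act≡actList-toList [] X Y = refl
act≡actList-toList (≺ ∷ ω) [] Y = refl
act≡actList-toList (≺ ∷ ω) (x ∷ X) Y = cong (x ∷_) (act≡actList-toList ω X Y)
act≡actList-toList (≻ ∷ ω) X [] = refl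
act≡actList-toList (≻ ∷ ω) X (y ∷ Y) = cong (y ∷_) (act≡actList-toList ω X Y)

length-actList : (ω : List Op) (X Y : List A) → length (actList ω X Y) ≡ length X + length Y
length-actList [] X Y = length-++ X
length-actList (≺ ∷ ω) [] Y = refl
length-actList (≺ ∷ ω) (x ∷ X) Y = cong suc (length-actList ω X Y)
length-actList (≻ ∷ ω) X [] = length-++ X
length-actList (≻ ∷ ω) X (y ∷ Y) =
  trans (cong suc (length-actList ω X Y)) (sym (+-suc (length X) (length Y)))

actList-replicate-≺ : (m : ℕ) (X Y : List A) → actList (replicate m ≺) X Y ≡ X ++ Y
actList-replicate-≺ zero X Y = refl
actList-replicate-≺ (suc m) [] Y = refl
actList-replicate-≺ (suc m) (x ∷ X) Y = cong (x ∷_) (actList-replicate-≺ m X Y)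

actList-++-replicate-≺ : (ω : List Op) (m : ℕ) (X Y : List A) →
  actList (ω ++ replicate m ≺) X Y ≡ actList ω X Y
actList-++-replicate-≺ [] m X Y = actList-replicate-≺ m X Y
actList-++-replicate-≺ (≺ ∷ ω) m [] Y = refl
actList-++-replicate-≺ (≺ ∷ ω) m (x ∷ X) Y = cong (x ∷_) (actList-++-replicate-≺ ω m X Y)
actList-++-replicate-≺ (≻ ∷ ω) m X [] = refl
actList-++-replicate-≺ (≻ ∷ ω) m X (y ∷ Y) = cong (y ∷_) (actList-++-replicate-≺ ω m X Y)

toList-tabulate-nth : (g : Maybe B → Op) (L : List B) → length L ≤ k →
  toList (tabulate {n = k} (g ∘ nth L ∘ toℕ))
    ≡ map (g ∘ just) L ++ replicate (k ∸ length L) (g nothing)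
toList-tabulate-nth {k = zero} g [] z≤n = refl
toList-tabulate-nth {k = suc k} g [] z≤n = cong (g nothing ∷_) (toList-tabulate-nth g [] z≤n)
toList-tabulate-nth {k = suc k} g (x ∷ L) (s≤s h) =
  cong (g (just x) ∷_) (toList-tabulate-nth g L h)

act-tabulate-nth : (g : Maybe B → Op) → g nothing ≡ ≺ → (L : List B) → length L ≤ k →
  (X Y : List A) →
  act (tabulate {n = k} (g ∘ nth L ∘ toℕ)) X Y ≡ actList (map (g ∘ just) L) X Y
act-tabulate-nth {k = k} g g-nothing L h X Y = begin
  act (tabulate {n = k} (g ∘ nth L ∘ toℕ)) X Y
    ≡⟨ act≡actList-toList (tabulate {n = k} (g ∘ nth L ∘ toℕ)) X Y ⟩
  actList (toList (tabulate {n = k} (g ∘ nth L ∘ toℕ))) X Y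
    ≡⟨ cong (λ ω → actList ω X Y) (toList-tabulate-nth g L h) ⟩
  actList (map (g ∘ just) L ++ replicate (k ∸ length L) (g nothing)) X Y
    ≡⟨ cong (λ o → actList (map (g ∘ just) L ++ replicate (k ∸ length L) o) X Y) g-nothing ⟩
  actList (map (g ∘ just) L ++ replicate (k ∸ length L) ≺) X Y
    ≡⟨ actList-++-replicate-≺ (map (g ∘ just) L) (k ∸ length L) X Y ⟩
  actList (map (g ∘ just) L) X Y ∎
  where open ≡-Reasoning

act-tabulate-lookup : (f : B → Op) (p : Vec B k) (X Y : List A) →
  act (tabulate (f ∘ lookup p)) X Y ≡ actList (map f (toList p)) X Y
act-tabulate-lookup f p X Y = begin
  act (tabulate (f ∘ lookup p)) X Y
    ≡⟨ act≡actList-toList (tabulate (f ∘ lookup p)) X Y ⟩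
  actList (toList (tabulate (f ∘ lookup p))) X Y
    ≡⟨ cong (λ ω → actList (toList ω) X Y) (tabulate-∘ f (lookup p)) ⟩
  actList (toList (Vec.map f (tabulate (lookup p)))) X Y
    ≡⟨ cong (λ ω → actList (toList (Vec.map f ω)) X Y) (tabulate∘lookup p) ⟩
  actList (toList (Vec.map f p)) X Y
    ≡⟨ cong (λ ω → actList ω X Y) (toList-map f p) ⟩
  actList (map f (toList p)) X Y ∎
  where open ≡-Reasoning

length-sub23≤ : (L : List P) → length (sub23 L) ≤ length L
length-sub23≤ [] = z≤n
length-sub23≤ (p1 ∷ L) = m≤n⇒m≤1+n (length-sub23≤ L)
length-sub23≤ (p2 ∷ L) = s≤s (length-sub23≤ L)
length-sub23≤ (p3 ∷ L) = s≤s (length-sub23≤ L)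

length-sub12≤ : (L : List P) → length (sub12 L) ≤ length L
length-sub12≤ [] = z≤n
length-sub12≤ (p1 ∷ L) = s≤s (length-sub12≤ L)
length-sub12≤ (p2 ∷ L) = s≤s (length-sub12≤ L)
length-sub12≤ (p3 ∷ L) = m≤n⇒m≤1+n (length-sub12≤ L)

actList-citelangis-relation : (L : List P) (X Y Z : List A) →
  length L ≤ length X → length L ≤ length Y → length L ≤ length Z →
  actList (map aOp L) X (actList (map (bAt ∘ just) (sub23 L)) Y Z)
    ≡ actList (map cOp L) (actList (map (dAt ∘ just) (sub12 L)) X Y) Z
actList-citelangis-relation [] X Y Z _ _ _ = sym (++-assoc X Y Z)
actList-citelangis-relation (p1 ∷ L) (x ∷ X) Y Z (s≤s hx) hy hz =
  cong (x ∷_) (actList-citelangis-relation L X Y Z hx (<⇒≤ hy) (<⇒≤ hz))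
actList-citelangis-relation (p2 ∷ L) X (y ∷ Y) Z hx (s≤s hy) hz =
  cong (y ∷_) (actList-citelangis-relation L X Y Z (<⇒≤ hx) hy (<⇒≤ hz))
actList-citelangis-relation (p3 ∷ L) X Y (z ∷ Z) hx hy (s≤s hz) =
  cong (z ∷_) (actList-citelangis-relation L X Y Z (<⇒≤ hx) (<⇒≤ hy) hz)

length-act : (ω : Vec Op k) (X Y : List A) → length (act ω X Y) ≡ length X + length Y
length-act ω X Y = trans (cong length (act≡actList-toList ω X Y)) (length-actList (toList ω) X Y)

act-precᵏ : (k : ℕ) (X Y : List A) → act (precᵏ k) X Y ≡ X ++ Y
act-precᵏ k X Y = begin
  act (precᵏ k) X Y                  ≡⟨ act≡actList-toList (precᵏ k) X Y ⟩
  actList (toList (precᵏ k)) X Y     ≡⟨ cong (λ ω → actList ω X Y) (toList-replicate k ≺) ⟩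
  actList (replicate k ≺) X Y        ≡⟨ actList-replicate-≺ k X Y ⟩
  X ++ Y                             ∎
  where open ≡-Reasoning

act-citelangis-relation : (p : Vec P k) (X Y Z : List A) →
  k ≤ length X → k ≤ length Y → k ≤ length Z →
  act (a p) X (act (b p) Y Z) ≡ act (c p) (act (d p) X Y) Z
act-citelangis-relation {k = k} p X Y Z hx hy hz = begin
  act (a p) X (act (b p) Y Z)
    ≡⟨ act-tabulate-lookup aOp p X (act (b p) Y Z) ⟩
  actList (map aOp L) X (act (b p) Y Z)
    ≡⟨ cong (actList (map aOp L) X) (act-tabulate-nth bAt refl L23 |L23|≤k Y Z) ⟩
  actList (map aOp L) X (actList (map (bAt ∘ just) L23) Y Z)
    ≡⟨ actList-citelangis-relation L X Y Z (|L|≤ hx) (|L|≤ hy) (|L|≤ hz) ⟩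
  actList (map cOp L) (actList (map (dAt ∘ just) L12) X Y) Z
    ≡⟨ cong (λ W → actList (map cOp L) W Z) (sym (act-tabulate-nth dAt refl L12 |L12|≤k X Y)) ⟩
  actList (map cOp L) (act (d p) X Y) Z
    ≡⟨ sym (act-tabulate-lookup cOp p (act (d p) X Y) Z) ⟩
  act (c p) (act (d p) X Y) Z ∎
  where
  open ≡-Reasoning
  L = toList p
  L23 = sub23 L
  L12 = sub12 L
  |L|≤ : ∀ {m} → k ≤ m → length L ≤ m
  |L|≤ = subst (_≤ _) (sym (length-toList p))
  |L23|≤k : length L23 ≤ k
  |L23|≤k = subst (length L23 ≤_) (length-toList p) (length-sub23≤ L)
  |L12|≤k : length L12 ≤ k
  |L12|≤k = subst (length L12 ≤_) (length-toList p) (length-sub12≤ L)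

proposition5p40 : (n k : ℕ) → 1 ≤ k →
    ((ω : Vec Op k) (X Y : List (Fin n)) → k ≤ length X → k ≤ length Y →
        k ≤ length (act ω X Y))
    × ((p : Vec P k) (X Y Z : List (Fin n)) →
        k ≤ length X → k ≤ length Y → k ≤ length Z →
        act (a p) X (act (b p) Y Z) ≡ act (c p) (act (d p) X Y) Z)
    × ((X Y : List (Fin n)) → k ≤ length X → k ≤ length Y →
        act (precᵏ k) X Y ≡ X ++ Y)
proposition5p40 n k _ = closed , act-citelangis-relation , λ X Y _ _ → act-precᵏ k X Y
  where
  closed : (ω : Vec Op k) (X Y : List (Fin n)) → k ≤ length X → k ≤ length Y →
    k ≤ length (act ω X Y)
  closed ω X Y hx _ =
    subst (k ≤_) (sym (length-act ω X Y)) (≤-trans hx (m≤m+n (length X) (length Y)))
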